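{- For every integer $n \geq 5$, $rsat(n,C_4) \geq 3\left\lceil\frac{n-1}{2}\right\rceil$.
   Context: All graphs are finite, simple and undirected. An edge-coloring of a graph $G$ is a function $\mathcal{C}:E(G)\to\mathbb{N}$; a (sub)graph is rainbow if all its edges have distinct colors. An edge-colored graph $G$ is $F$-rainbow saturated if it contains no rainbow copy of $F$ but adding any nonedge of $G$ with any color on it creates a rainbow copy of $F$. $rsat(n,F)$ is the minimum number of edges of a graph on $n$ vertices admitting an edge-coloring that makes it $F$-rainbow saturated. $C_4$ is the cycle on 4 vertices. -}

module Defs where

open import Data.Nat using (ℕ; zero; suc; _+_; _<ᵇ_; _≤_)
open import Data.Nat.ListAction using (sum)
open import Data.Empty using (⊥)
open import Data.Bool using (Bool; true; false; _∨_; _∧_; if_then_else_)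
open import Data.Fin using (Fin; toℕ)
open import Data.Fin.Properties using (_≟_)
open import Data.List using (List; map; allFin)
open import Data.Product using (Σ; _×_; ∃-syntax)
open import Relation.Binary.PropositionalEquality using (_≡_; _≢_)
open import Relation.Nullary.Decidable using (⌊_⌋)

record SimpleGraph (n : ℕ) : Set where
  field
    adj       : Fin n → Fin n → Bool
    adj-sym   : ∀ i j → adj i j ≡ adj j i
    adj-irrefl : ∀ i → adj i i ≡ false
open SimpleGraph public

-- An edge-colouring: a colour in ℕ for each (unordered) pair; we require
-- symmetry so that the colour of edge {i,j} is well defined.  Values on
-- non-edges are irrelevant.
record EdgeColoring (n : ℕ) : Set where
  field
    col     : Fin n → Fin n → ℕ
    col-sym : ∀ i j → col i j ≡ col j i
open EdgeColoring public

edgeCount : ∀ {n} → SimpleGraph n → ℕ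
edgeCount {n} G =
  sum (map (λ i → sum (map (λ j → if (toℕ i <ᵇ toℕ j) ∧ adj G i j then 1 else 0)
                           (allFin n)))
           (allFin n))

samePair : ∀ {n} → Fin n → Fin n → Fin n → Fin n → Bool
samePair u v x y = (⌊ x ≟ u ⌋ ∧ ⌊ y ≟ v ⌋) ∨ (⌊ x ≟ v ⌋ ∧ ⌊ y ≟ u ⌋)

RainbowC4 : ∀ {n} → (Fin n → Fin n → Bool) → (Fin n → Fin n → ℕ) → Set
RainbowC4 {n} A C =
  ∃[ a ] ∃[ b ] ∃[ c ] ∃[ d ]
    ( (a ≢ b × a ≢ c × a ≢ d × b ≢ c × b ≢ d × c ≢ d)
    × (A a b ≡ true × A b c ≡ true × A c d ≡ true × A d a ≡ true)
    × ( C a b ≢ C b c × C a b ≢ C c d × C a b ≢ C d a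
      × C b c ≢ C c d × C b c ≢ C d a × C c d ≢ C d a ) )

addEdgeAdj : ∀ {n} → SimpleGraph n → Fin n → Fin n → Fin n → Fin n → Bool
addEdgeAdj G u v x y = adj G x y ∨ samePair u v x y

addEdgeCol : ∀ {n} → EdgeColoring n → Fin n → Fin n → ℕ → Fin n → Fin n → ℕ
addEdgeCol C u v k x y = if samePair u v x y then k else col C x y

C4RainbowSaturated : ∀ {n} → SimpleGraph n → EdgeColoring n → Set
C4RainbowSaturated G C =
  (RainbowC4 (adj G) (col C) → ⊥)
  × (∀ u v → u ≢ v → adj G u v ≡ false → ∀ (k : ℕ) →
       RainbowC4 (addEdgeAdj G u v) (addEdgeCol C u v k))

-- rsat(n, C4) ≥ m  :⇔  every n-vertex graph admitting a C4-rainbow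
-- saturated colouring has at least m edges.
RsatC4AtLeast : ℕ → ℕ → Set
RsatC4AtLeast n m =
  ∀ (G : SimpleGraph n) (C : EdgeColoring n) → C4RainbowSaturated G C → m ≤ edgeCount G

module Submission where

-- Adding a missing edge uv with any colour k creates a rainbow C₄, necessarily through uv, so u and v
-- are joined by a path of length three none of whose edges has colour k.  Taking for k the colour of a
-- suitable edge makes these paths rigid around vertices of degree two ("low" vertices): every degree is
-- at least 2, two adjacent low vertices force a universal vertex, two nonadjacent low vertices never
-- have the same neighbourhood, and so on.  From this the degree sum is at least 3n − 1, or exactly
-- 3n − 3 (a universal vertex with all other vertices low).  With a universal vertex this is direct
-- counting.  Otherwise the low vertices are independent, and discharging (each low vertex takes half a
-- unit from each neighbour) works unless a vertex w of degree 3 has a low neighbour v.  Then every vertex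
-- other than v, w and the second neighbour y of v is adjacent to one of the two other neighbours a, b
-- of w, and counting these adjacencies a second time pays for the deficit.  As the degree sum is 2e,
-- parity turns the two alternatives into the bound on e.

open import Defs
open import Data.Nat.Properties renaming (_≟_ to _≟ℕ_)
open import Algebra.Properties.CommutativeSemigroup +-commutativeSemigroup
  using (x∙yz≈xz∙y; xy∙z≈xz∙y; xy∙z≈z∙xy)
open import Algebra.Properties.Semiring.Sum +-*-semiring
  using (sum; ∑-distrib-+; ∑-comm; sum-cong-≗; *-distribˡ-sum; *-distribʳ-sum)
open import Data.Bool using (Bool; true; false; if_then_else_; _∧_; _∨_; not; T)
open import Data.Bool.Properties
  using (¬-not; T-≡; T-∧; T-∨; ∧-zeroʳ; ∧-identityʳ; ∨-identityʳ) renaming (_≟_ to _≟ᵇ_)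
open import Data.Empty using (⊥; ⊥-elim)
open import Data.Fin using (Fin; zero; suc; toℕ)
open import Data.Fin.Properties using (_≟_; any?; all?; toℕ-injective)
open import Data.List using (List; []; _∷_; [_]; length; map; allFin; tabulate)
open import Data.List.Membership.Propositional using (_∈_; _∉_)
open import Data.List.Properties using (map-cong; map-cong-local; map-tabulate)
open import Data.List.Relation.Unary.All as All using (All; []; _∷_)
open import Data.List.Relation.Unary.All.Properties using (¬Any⇒All¬)
open import Data.List.Relation.Unary.Any as Any using (here; there)
open import Data.List.Relation.Unary.Unique.Propositional using (Unique; []; _∷_)
open import Data.Nat using (ℕ; zero; suc; _+_; _*_; _∸_; _≤_; _<_; _≤?_; _<ᵇ_; z≤n; s≤s; ⌈_/2⌉; ⌊_/2⌋)
import Data.Nat.ListAction as List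
open import Data.Nat.Tactic.RingSolver using (solve-∀)
open import Data.Product as Product using (_×_; _,_; proj₁; proj₂; ∃)
open import Data.Sum as Sum using (_⊎_; inj₁; inj₂; [_,_]′)
open import Data.Vec.Functional using (Vector; updateAt)
open import Data.Vec.Functional.Properties using (updateAt-updates; updateAt-minimal)
open import Function using (_∘_; id; const)
open import Function.Bundles using (Equivalence)
open import Relation.Binary.PropositionalEquality
  using (_≡_; _≢_; refl; sym; trans; cong; cong₂; subst; module ≡-Reasoning)
open import Relation.Nullary using (¬_; Dec; does; yes; no; contradiction)
open import Relation.Nullary.Decidable
  using (_×-dec_; _→-dec_; ¬?; ⌊_⌋; toWitness; decidable-stable; dec-true; dec-false)
open import Relation.Nullary.Reflects using (ofʸ; ofⁿ)

-- Finite sums of natural numbers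

∑-mono-≤ : ∀ {n} {f g : Vector ℕ n} → (∀ i → f i ≤ g i) → sum f ≤ sum g
∑-mono-≤ {zero}  f≤g = z≤n
∑-mono-≤ {suc n} f≤g = +-mono-≤ (f≤g zero) (∑-mono-≤ (f≤g ∘ suc))

∑-const : ∀ n c → sum {n} (const c) ≡ n * c
∑-const zero    c = refl
∑-const (suc n) c = cong (c +_) (∑-const n c)

sum-updateAt : ∀ {n} (f : Vector ℕ n) i (g : ℕ → ℕ) → sum (updateAt f i g) + f i ≡ sum f + g (f i)
sum-updateAt f zero g = begin
  g (f zero) + sum (f ∘ suc) + f zero    ≡⟨ xy∙z≈z∙xy (g (f zero)) _ _ ⟩
  f zero + (g (f zero) + sum (f ∘ suc))  ≡⟨ x∙yz≈xz∙y (f zero) _ _ ⟩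
  f zero + sum (f ∘ suc) + g (f zero)    ∎
  where open ≡-Reasoning
sum-updateAt f (suc i) g = begin
  f zero + sum (updateAt (f ∘ suc) i g) + f (suc i)    ≡⟨ +-assoc (f zero) _ _ ⟩
  f zero + (sum (updateAt (f ∘ suc) i g) + f (suc i))  ≡⟨ cong (f zero +_) (sum-updateAt (f ∘ suc) i g) ⟩
  f zero + (sum (f ∘ suc) + g (f (suc i)))            ≡⟨ +-assoc (f zero) _ _ ⟨
  f zero + sum (f ∘ suc) + g (f (suc i))              ∎
  where open ≡-Reasoning

∑-≥-outside : ∀ {n} {f : Vector ℕ n} {c} xs → Unique xs → (∀ i → i ∉ xs → c ≤ f i) →
              n * c + List.sum (map f xs) ≤ sum f + length xs * c
∑-≥-outside {n} {f} {c} [] _ c≤f = begin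
  n * c + 0          ≡⟨ +-identityʳ (n * c) ⟩
  n * c              ≡⟨ ∑-const n c ⟨
  sum {n} (const c)  ≤⟨ ∑-mono-≤ (λ i → c≤f i λ ()) ⟩
  sum f              ≡⟨ +-identityʳ (sum f) ⟨
  sum f + 0          ∎
  where open ≤-Reasoning
∑-≥-outside {n} {f} {c} (x ∷ xs) (x∉xs ∷ unique) c≤f = begin
  n * c + (f x + Σxs)             ≡⟨ x∙yz≈xz∙y (n * c) (f x) Σxs ⟩
  n * c + Σxs + f x               ≡⟨ cong (λ s → n * c + s + f x) same ⟨
  n * c + Σ′xs + f x              ≤⟨ +-monoˡ-≤ (f x) (∑-≥-outside xs unique c≤f′) ⟩
  sum f′ + length xs * c + f x    ≡⟨ xy∙z≈xz∙y (sum f′) _ (f x) ⟩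
  sum f′ + f x + length xs * c    ≡⟨ cong (_+ length xs * c) (sum-updateAt f x (const c)) ⟩
  sum f + c + length xs * c       ≡⟨ +-assoc (sum f) c _ ⟩
  sum f + (c + length xs * c)     ∎
  where
  open ≤-Reasoning
  f′ : Vector ℕ n
  f′ = updateAt f x (const c)
  Σxs Σ′xs : ℕ
  Σxs = List.sum (map f xs)
  Σ′xs = List.sum (map f′ xs)
  same : Σ′xs ≡ Σxs
  same = cong List.sum (map-cong-local (All.map (λ x≢y → updateAt-minimal _ x f (x≢y ∘ sym)) x∉xs))
  c≤f′ : ∀ i → i ∉ xs → c ≤ f′ i
  c≤f′ i i∉xs with i ≟ x
  ... | yes refl = ≤-reflexive (sym (updateAt-updates x f))
  ... | no i≢x   = subst (c ≤_) (sym (updateAt-minimal i x f i≢x))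
                     (c≤f i λ { (here i≡x) → i≢x i≡x ; (there i∈xs) → i∉xs i∈xs })

∑-≤-outside : ∀ {n} {f : Vector ℕ n} {c} x → (∀ i → i ≢ x → f i ≤ c) → sum f + c ≤ n * c + f x
∑-≤-outside {n} {f} {c} x f≤c = begin
  sum f + c                ≤⟨ +-monoˡ-≤ c (∑-mono-≤ f≤g) ⟩
  sum g + c                ≡⟨ sum-updateAt (const c) x (const (f x)) ⟩
  sum {n} (const c) + f x  ≡⟨ cong (_+ f x) (∑-const n c) ⟩
  n * c + f x              ∎
  where
  open ≤-Reasoning
  g : Vector ℕ n
  g = updateAt (const c) x (const (f x))
  f≤g : ∀ i → f i ≤ g i
  f≤g i with i ≟ x
  ... | yes refl = ≤-reflexive (sym (updateAt-updates x (const c)))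
  ... | no i≢x   = subst (f i ≤_) (sym (updateAt-minimal i x (const c) i≢x)) (f≤c i i≢x)

∑-≤-support : ∀ {n} {f : Vector ℕ n} {c} xs → (∀ i → i ∉ xs → f i ≡ 0) → (∀ i → f i ≤ c) →
              sum f ≤ length xs * c
∑-≤-support {n} {f} [] f≡0 _ = begin
  sum f              ≤⟨ ∑-mono-≤ (λ i → ≤-reflexive (f≡0 i λ ())) ⟩
  sum {n} (const 0)  ≡⟨ trans (∑-const n 0) (*-zeroʳ n) ⟩
  0                  ∎
  where open ≤-Reasoning
∑-≤-support {n} {f} {c} (x ∷ xs) f≡0 f≤c = begin
  sum f              ≡⟨ +-identityʳ (sum f) ⟨
  sum f + 0          ≡⟨ sum-updateAt f x (const 0) ⟨
  sum f′ + f x       ≤⟨ +-mono-≤ (∑-≤-support xs f′≡0 f′≤c) (f≤c x) ⟩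
  length xs * c + c  ≡⟨ +-comm _ c ⟩
  c + length xs * c  ∎
  where
  open ≤-Reasoning
  f′ : Vector ℕ n
  f′ = updateAt f x (const 0)
  f′≡0 : ∀ i → i ∉ xs → f′ i ≡ 0
  f′≡0 i i∉xs with i ≟ x
  ... | yes refl = updateAt-updates x f
  ... | no i≢x   = trans (updateAt-minimal i x f i≢x)
                     (f≡0 i λ { (here i≡x) → i≢x i≡x ; (there i∈xs) → i∉xs i∈xs })
  f′≤c : ∀ i → f′ i ≤ c
  f′≤c i with i ≟ x
  ... | yes refl = subst (_≤ c) (sym (updateAt-updates x f)) z≤n
  ... | no i≢x   = subst (_≤ c) (sym (updateAt-minimal i x f i≢x)) (f≤c i)

sum-allFin : ∀ n (f : Fin n → ℕ) → List.sum (map f (allFin n)) ≡ sum f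
sum-allFin n f = trans (cong List.sum (map-tabulate id f)) (sum-tabulate n f)
  where
  sum-tabulate : ∀ n (f : Fin n → ℕ) → List.sum (tabulate f) ≡ sum f
  sum-tabulate zero    f = refl
  sum-tabulate (suc n) f = cong (f zero +_) (sum-tabulate n (f ∘ suc))

-- Counting the points of a Boolean predicate

𝟙 : Bool → ℕ
𝟙 b = if b then 1 else 0

𝟙≤1 : ∀ b → 𝟙 b ≤ 1
𝟙≤1 true  = ≤-refl
𝟙≤1 false = z≤n

∧-true : ∀ {a b} → a ∧ b ≡ true → a ≡ true × b ≡ true
∧-true {true} b≡true = refl , b≡true

count : ∀ {n} → (Fin n → Bool) → ℕ
count p = sum (𝟙 ∘ p)

module _ {n} {p : Fin n → Bool} where

  unique⇒length≤count : ∀ {xs} → Unique xs → All (λ x → p x ≡ true) xs → length xs ≤ count p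
  unique⇒length≤count {xs} unique pxs = begin
    length xs                          ≡⟨ sum-𝟙 pxs ⟨
    List.sum (map (𝟙 ∘ p) xs)          ≡⟨ cong (_+ List.sum (map (𝟙 ∘ p) xs)) (*-zeroʳ n) ⟨
    n * 0 + List.sum (map (𝟙 ∘ p) xs)  ≤⟨ ∑-≥-outside xs unique (λ _ _ → z≤n) ⟩
    count p + length xs * 0            ≡⟨ cong (count p +_) (*-zeroʳ (length xs)) ⟩
    count p + 0                        ≡⟨ +-identityʳ (count p) ⟩
    count p                            ∎
    where
    open ≤-Reasoning
    sum-𝟙 : ∀ {xs} → All (λ x → p x ≡ true) xs → List.sum (map (𝟙 ∘ p) xs) ≡ length xs
    sum-𝟙 []         = refl
    sum-𝟙 (px ∷ pxs) = cong₂ _+_ (cong 𝟙 px) (sum-𝟙 pxs)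

  ⊆⇒count≤length : ∀ {xs} → (∀ i → p i ≡ true → i ∈ xs) → count p ≤ length xs
  ⊆⇒count≤length {xs} p⊆xs = subst (count p ≤_) (*-identityʳ (length xs))
    (∑-≤-support xs (λ i i∉xs → cong 𝟙 (¬-not (i∉xs ∘ p⊆xs i))) (𝟙≤1 ∘ p))

  length<count⇒∃∉ : ∀ {xs} → length xs < count p → ∃ λ i → p i ≡ true × i ∉ xs
  length<count⇒∃∉ {xs} |xs|<count with any? (λ i → (p i ≟ᵇ true) ×-dec ¬? (Any.any? (i ≟_) xs))
  ... | yes found = found
  ... | no none   = contradiction (⊆⇒count≤length p⊆xs) (<⇒≱ |xs|<count)
    where
    p⊆xs : ∀ i → p i ≡ true → i ∈ xs
    p⊆xs i pi with Any.any? (i ≟_) xs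
    ... | yes i∈xs = i∈xs
    ... | no i∉xs  = ⊥-elim (none (i , pi , i∉xs))

  count≤length⇒∈ : ∀ {xs i} → count p ≤ length xs → Unique xs → All (λ x → p x ≡ true) xs →
                   p i ≡ true → i ∈ xs
  count≤length⇒∈ {xs} {i} count≤ unique pxs pi with Any.any? (i ≟_) xs
  ... | yes i∈xs = i∈xs
  ... | no i∉xs  = contradiction (unique⇒length≤count (¬Any⇒All¬ xs i∉xs ∷ unique) (pi ∷ pxs)) (≤⇒≯ count≤)

count-∧-split : ∀ {n} (p q : Fin n → Bool) →
                count p ≡ count (λ i → p i ∧ q i) + count (λ i → p i ∧ not (q i))
count-∧-split p q = trans (sum-cong-≗ (λ i → 𝟙-split (p i) (q i)))
                          (∑-distrib-+ (λ i → 𝟙 (p i ∧ q i)) (λ i → 𝟙 (p i ∧ not (q i))))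
  where
  𝟙-split : ∀ a b → 𝟙 a ≡ 𝟙 (a ∧ b) + 𝟙 (a ∧ not b)
  𝟙-split false _     = refl
  𝟙-split true  true  = refl
  𝟙-split true  false = refl

∃-fresh : ∀ {n} (xs : List (Fin n)) → length xs < n → ∃ λ i → i ∉ xs
∃-fresh {n} xs |xs|<n = Product.map₂ proj₂ (length<count⇒∃∉ {p = const true}
  (subst (length xs <_) (sym (trans (∑-const n 1) (*-identityʳ n))) |xs|<n))

-- Degrees

module Graph {n} (G : SimpleGraph n) where

  infix 4 _~_ _≁_

  _~_ _≁_ : Fin n → Fin n → Set
  u ~ v = adj G u v ≡ true
  u ≁ v = adj G u v ≡ false

  _~?_ : ∀ u v → Dec (u ~ v)
  u ~? v = adj G u v ≟ᵇ true

  ~-sym : ∀ {u v} → u ~ v → v ~ u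
  ~-sym {u} {v} u~v = trans (adj-sym G v u) u~v

  ~-irrefl : ∀ {u} → ¬ u ~ u
  ~-irrefl {u} u~u with trans (sym (adj-irrefl G u)) u~u
  ... | ()

  ~⇒≢ : ∀ {u v} → u ~ v → u ≢ v
  ~⇒≢ u~v refl = ~-irrefl u~v

  ~⇒¬≁ : ∀ {u v} → u ~ v → ¬ u ≁ v
  ~⇒¬≁ u~v u≁v with trans (sym u~v) u≁v
  ... | ()

  deg : Fin n → ℕ
  deg u = count (adj G u)

  Universal : Fin n → Set
  Universal p = ∀ x → x ≢ p → p ~ x

  handshake : sum deg ≡ 2 * edgeCount G
  handshake = begin
    sum (λ i → sum (λ j → 𝟙 (adj G i j)))
      ≡⟨ sum-cong-≗ (λ i → sum-cong-≗ (λ j → sym (forward+backward i j))) ⟩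
    sum (λ i → sum (λ j → forward i j + forward j i))
      ≡⟨ sum-cong-≗ (λ i → ∑-distrib-+ (forward i) (λ j → forward j i)) ⟩
    sum (λ i → sum (forward i) + sum (λ j → forward j i))
      ≡⟨ ∑-distrib-+ (sum ∘ forward) _ ⟩
    sum (sum ∘ forward) + sum (λ i → sum (λ j → forward j i))
      ≡⟨ cong (sum (sum ∘ forward) +_) (∑-comm (λ i j → forward j i)) ⟩
    sum (sum ∘ forward) + sum (sum ∘ forward)
      ≡⟨ cong₂ _+_ edgeCount≡ edgeCount≡ ⟩
    edgeCount G + edgeCount G
      ≡⟨ cong (edgeCount G +_) (+-identityʳ (edgeCount G)) ⟨
    2 * edgeCount G
      ∎
    where
    open ≡-Reasoning
    forward : Fin n → Fin n → ℕ
    forward i j = if (toℕ i <ᵇ toℕ j) ∧ adj G i j then 1 else 0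
    edgeCount≡ : sum (sum ∘ forward) ≡ edgeCount G
    edgeCount≡ = sym (trans (cong List.sum (map-cong (λ i → sum-allFin n (forward i)) (allFin n)))
                            (sum-allFin n (sum ∘ forward)))
    forward+backward : ∀ i j → forward i j + forward j i ≡ 𝟙 (adj G i j)
    forward+backward i j
      with toℕ i <ᵇ toℕ j | <ᵇ-reflects-< (toℕ i) (toℕ j) | toℕ j <ᵇ toℕ i | <ᵇ-reflects-< (toℕ j) (toℕ i)
    ... | true  | ofʸ i<j | true  | ofʸ j<i = contradiction i<j (<-asym j<i)
    ... | true  | _       | false | _       = +-identityʳ _
    ... | false | _       | true  | _       = cong 𝟙 (adj-sym G j i)
    ... | false | ofⁿ i≮j | false | ofⁿ j≮i with toℕ-injective (≤-antisym (≮⇒≥ j≮i) (≮⇒≥ i≮j))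
    ...   | refl = cong 𝟙 (sym (adj-irrefl G i))

-- A rainbow C₄ through a new edge

module Colouring {n} (G : SimpleGraph n) (C : EdgeColoring n) where

  open Graph G

  record AvoidingPath (u v : Fin n) (k : ℕ) : Set where
    constructor path
    field
      {mid₁ mid₂} : Fin n
      edge₁   : u ~ mid₁
      edge₂   : mid₁ ~ mid₂
      edge₃   : mid₂ ~ v
      colour₁ : col C u mid₁ ≢ k
      colour₂ : col C mid₁ mid₂ ≢ k
      colour₃ : col C mid₂ v ≢ k

  reverse : ∀ {u v k} → AvoidingPath v u k → AvoidingPath u v k
  reverse {u} {v} (path {x} {y} v~x x~y y~u c₁ c₂ c₃) =
    path (~-sym y~u) (~-sym x~y) (~-sym v~x)
      (c₃ ∘ trans (col-sym C y u)) (c₂ ∘ trans (col-sym C x y)) (c₁ ∘ trans (col-sym C v x))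

  rotate : ∀ {A K} → RainbowC4 {n} A K → RainbowC4 A K
  rotate (a , b , c , d , (a≢b , a≢c , a≢d , b≢c , b≢d , c≢d) , (ab , bc , cd , da) ,
          (ab≢bc , ab≢cd , ab≢da , bc≢cd , bc≢da , cd≢da)) =
    b , c , d , a , (b≢c , b≢d , a≢b ∘ sym , c≢d , a≢c ∘ sym , a≢d ∘ sym) , (bc , cd , da , ab) ,
    (bc≢cd , bc≢da , ab≢bc ∘ sym , cd≢da , ab≢cd ∘ sym , ab≢da ∘ sym)

  module _ {u v : Fin n} {k : ℕ} where

    private
      A′ : Fin n → Fin n → Bool
      A′ = addEdgeAdj G u v
      C′ : Fin n → Fin n → ℕ
      C′ = addEdgeCol C u v k

      samePair-true : ∀ {x y} → samePair u v x y ≡ true → (x ≡ u × y ≡ v) ⊎ (x ≡ v × y ≡ u)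
      samePair-true h = Sum.map both both (Equivalence.to T-∨ (Equivalence.from T-≡ h))
        where
        both : ∀ {a b c d : Fin n} → T (⌊ a ≟ b ⌋ ∧ ⌊ c ≟ d ⌋) → a ≡ b × c ≡ d
        both {a} {b} {c} {d} t with Equivalence.to (T-∧ {⌊ a ≟ b ⌋} {⌊ c ≟ d ⌋}) t
        ... | a≟b , c≟d = toWitness {a? = a ≟ b} a≟b , toWitness {a? = c ≟ d} c≟d

      samePair-falseˡ : ∀ {x y} → x ≢ u → x ≢ v → samePair u v x y ≡ false
      samePair-falseˡ {x} x≢u x≢v with x ≟ u | x ≟ v
      ... | yes x≡u | _       = contradiction x≡u x≢u
      ... | no _    | yes x≡v = contradiction x≡v x≢v
      ... | no _    | no _    = refl

      samePair-falseʳ : ∀ {x y} → y ≢ u → y ≢ v → samePair u v x y ≡ false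
      samePair-falseʳ {x} {y} y≢u y≢v with y ≟ v | y ≟ u
      ... | yes y≡v | _       = contradiction y≡v y≢v
      ... | no _    | yes y≡u = contradiction y≡u y≢u
      ... | no _    | no _    = cong₂ _∨_ (∧-zeroʳ ⌊ x ≟ u ⌋) (∧-zeroʳ ⌊ x ≟ v ⌋)

      old-edge : ∀ {x y} → samePair u v x y ≡ false → A′ x y ≡ true → x ~ y
      old-edge {x} {y} old x~′y =
        trans (sym (∨-identityʳ (adj G x y))) (subst (λ b → adj G x y ∨ b ≡ true) old x~′y)

      old-colour : ∀ {x y} → samePair u v x y ≡ false → C′ x y ≡ col C x y
      old-colour old rewrite old = refl

      new-colour : ∀ {x y} → samePair u v x y ≡ true → C′ x y ≡ k
      new-colour new rewrite new = refl

      off-pair : ∀ {a b z} → samePair u v a b ≡ true → z ≢ a → z ≢ b → z ≢ u × z ≢ v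
      off-pair {a} {b} new z≢a z≢b with samePair-true {a} {b} new
      ... | inj₁ (refl , refl) = z≢a , z≢b
      ... | inj₂ (refl , refl) = z≢b , z≢a

      backwards : (R : RainbowC4 A′ C′) → samePair u v (proj₁ R) (proj₁ (proj₂ R)) ≡ true →
                  AvoidingPath (proj₁ (proj₂ R)) (proj₁ R) k
      backwards (a , b , c , d , (_ , a≢c , a≢d , b≢c , b≢d , _) , (_ , bc , cd , da) ,
                 (ab≢bc , ab≢cd , ab≢da , _ , _ , _)) new =
        path (old-edge bc-old bc) (old-edge cd-old cd) (old-edge da-old da)
          (avoids ab≢bc bc-old) (avoids ab≢cd cd-old) (avoids ab≢da da-old)
        where
        c-off : c ≢ u × c ≢ v
        c-off = off-pair new (a≢c ∘ sym) (b≢c ∘ sym)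
        d-off : d ≢ u × d ≢ v
        d-off = off-pair new (a≢d ∘ sym) (b≢d ∘ sym)
        bc-old : samePair u v b c ≡ false
        bc-old = samePair-falseʳ {b} (proj₁ c-off) (proj₂ c-off)
        cd-old : samePair u v c d ≡ false
        cd-old = samePair-falseˡ (proj₁ c-off) (proj₂ c-off)
        da-old : samePair u v d a ≡ false
        da-old = samePair-falseˡ (proj₁ d-off) (proj₂ d-off)
        avoids : ∀ {x y} → C′ a b ≢ C′ x y → samePair u v x y ≡ false → col C x y ≢ k
        avoids ne old e = ne (trans (new-colour new) (sym (trans (old-colour old) e)))

      around : (R : RainbowC4 A′ C′) → samePair u v (proj₁ R) (proj₁ (proj₂ R)) ≡ true →
               AvoidingPath u v k
      around R@(a , b , _) new with samePair-true {a} {b} new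
      ... | inj₁ (refl , refl) = reverse (backwards R new)
      ... | inj₂ (refl , refl) = backwards R new

      old-cycle : (R : RainbowC4 A′ C′) → let (a , b , c , d , _) = R in
                  samePair u v a b ≡ false → samePair u v b c ≡ false →
                  samePair u v c d ≡ false → samePair u v d a ≡ false → RainbowC4 (adj G) (col C)
      old-cycle (a , b , c , d , distinct , (ab , bc , cd , da) , (c₁₂ , c₁₃ , c₁₄ , c₂₃ , c₂₄ , c₃₄))
                o₁ o₂ o₃ o₄ =
        a , b , c , d , distinct , (old-edge o₁ ab , old-edge o₂ bc , old-edge o₃ cd , old-edge o₄ da) ,
        (old≢ o₁ o₂ c₁₂ , old≢ o₁ o₃ c₁₃ , old≢ o₁ o₄ c₁₄ , old≢ o₂ o₃ c₂₃ , old≢ o₂ o₄ c₂₄ , old≢ o₃ o₄ c₃₄)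
        where
        old≢ : ∀ {w x y z} → samePair u v w x ≡ false → samePair u v y z ≡ false →
               C′ w x ≢ C′ y z → col C w x ≢ col C y z
        old≢ o o′ ne e = ne (trans (old-colour o) (trans e (sym (old-colour o′))))

    rainbow-through-new-edge : ¬ RainbowC4 (adj G) (col C) → RainbowC4 A′ C′ → AvoidingPath u v k
    rainbow-through-new-edge no-old R@(a , b , c , d , _)
      with samePair u v a b ≟ᵇ true | samePair u v b c ≟ᵇ true
         | samePair u v c d ≟ᵇ true | samePair u v d a ≟ᵇ true
    ... | yes new | _       | _       | _       = around R new
    ... | no _    | yes new | _       | _       = around (rotate R) new
    ... | no _    | no _    | yes new | _       = around (rotate (rotate R)) new
    ... | no _    | no _    | no _    | yes new = around (rotate (rotate (rotate R))) new
    ... | no o₁   | no o₂   | no o₃   | no o₄   =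
      contradiction (old-cycle R (¬-not o₁) (¬-not o₂) (¬-not o₃) (¬-not o₄)) no-old

-- Rainbow-saturated graphs

module Saturated {n} (5≤n : 5 ≤ n) (G : SimpleGraph n) (C : EdgeColoring n)
                 (saturated : C4RainbowSaturated G C) where

  open Graph G
  open Colouring G C

  avoidingPath : ∀ {u v} → u ≢ v → u ≁ v → ∀ k → AvoidingPath u v k
  avoidingPath u≢v u≁v k = rainbow-through-new-edge (proj₁ saturated) (proj₂ saturated _ _ u≢v u≁v k)

  neighbour-≢ : ∀ u x → ∃ λ z → u ~ z × z ≢ x
  neighbour-≢ u x with ∃-fresh (u ∷ x ∷ []) (≤-trans (s≤s (s≤s (s≤s z≤n))) 5≤n)
  ... | w , w∉ with u ~? w
  ...   | yes u~w = w , u~w , w∉ ∘ there ∘ here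
  ...   | no ¬u~w with avoidingPath (w∉ ∘ here ∘ sym) (¬-not ¬u~w) (col C u x)
  ...     | path u~z _ _ c₁ _ _ = _ , u~z , c₁ ∘ cong (col C u)

  deg≥2 : ∀ u → 2 ≤ deg u
  deg≥2 u with neighbour-≢ u u
  ... | z₁ , u~z₁ , _ with neighbour-≢ u z₁
  ...   | z₂ , u~z₂ , z₂≢z₁ = unique⇒length≤count ((z₂≢z₁ ∷ []) ∷ [] ∷ []) (u~z₂ ∷ u~z₁ ∷ [])

  -- By deg≥2, a low vertex has degree exactly two.
  Low : Fin n → Set
  Low u = deg u ≤ 2

  low? : ∀ u → Dec (Low u)
  low? u = deg u ≤? 2

  record Neighbourhood₂ (v x y : Fin n) : Set where
    field
      x≢y  : x ≢ y
      v~x  : v ~ x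
      v~y  : v ~ y
      only : ∀ {z} → v ~ z → z ≡ x ⊎ z ≡ y

  open Neighbourhood₂

  swap : ∀ {v x y} → Neighbourhood₂ v x y → Neighbourhood₂ v y x
  swap N = record { x≢y = x≢y N ∘ sym ; v~x = v~y N ; v~y = v~x N ; only = Sum.swap ∘ only N }

  low⇒Neighbourhood₂ : ∀ {v x y} → Low v → x ≢ y → v ~ x → v ~ y → Neighbourhood₂ v x y
  low⇒Neighbourhood₂ {v} {x} {y} low x≢y v~x v~y = record { x≢y = x≢y ; v~x = v~x ; v~y = v~y ; only = only′ }
    where
    only′ : ∀ {z} → v ~ z → z ≡ x ⊎ z ≡ y
    only′ v~z with count≤length⇒∈ low ((x≢y ∷ []) ∷ [] ∷ []) (v~x ∷ v~y ∷ []) v~z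
    ... | here z≡x         = inj₁ z≡x
    ... | there (here z≡y) = inj₂ z≡y

  low⇒∃Neighbourhood₂ : ∀ {v x} → Low v → v ~ x → ∃ λ y → Neighbourhood₂ v x y
  low⇒∃Neighbourhood₂ {v} {x} low v~x with neighbour-≢ v x
  ... | y , v~y , y≢x = y , low⇒Neighbourhood₂ low (y≢x ∘ sym) v~x v~y

  Neighbourhood₂⇒low : ∀ {v x y} → Neighbourhood₂ v x y → Low v
  Neighbourhood₂⇒low {x = x} {y} N =
    ⊆⇒count≤length {xs = x ∷ y ∷ []} λ _ v~z → [ here , there ∘ here ]′ (only N v~z)

  -- Colour the missing edge vt like vy: the rainbow C₄ through vt must then leave v along vw.
  two-steps-from : ∀ {v w y t} → Neighbourhood₂ v w y → t ≢ v → v ≁ t → ∃ λ β → w ~ β × β ~ t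
  two-steps-from {v} {y = y} N t≢v v≁t with avoidingPath (t≢v ∘ sym) v≁t (col C v y)
  ... | path v~α α~β β~t c₁ _ _ with only N v~α
  ...   | inj₁ refl = _ , α~β , β~t
  ...   | inj₂ refl = contradiction refl c₁

  -- Colour the missing edge q₁q₂ like xy: the middle edge of the path would have to be xy itself.
  no-twins : ∀ {q₁ q₂ x y} → Neighbourhood₂ q₁ x y → Neighbourhood₂ q₂ x y → q₁ ≢ q₂ → q₁ ≁ q₂ → ⊥
  no-twins {x = x} {y} N₁ N₂ q₁≢q₂ q₁≁q₂ with avoidingPath q₁≢q₂ q₁≁q₂ (col C x y)
  ... | path q₁~α α~β β~q₂ _ c₂ _ with only N₁ q₁~α | only N₂ (~-sym β~q₂)
  ...   | inj₁ refl | inj₁ refl = ~-irrefl α~β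
  ...   | inj₂ refl | inj₂ refl = ~-irrefl α~β
  ...   | inj₁ refl | inj₂ refl = c₂ refl
  ...   | inj₂ refl | inj₁ refl = c₂ (col-sym C y x)

  shared-neighbour-adjacent : ∀ {v u y w q} → Neighbourhood₂ v y w → Neighbourhood₂ u y q →
                              v ≢ u → u ≁ v → y ~ w
  shared-neighbour-adjacent Nv Nu v≢u u≁v with two-steps-from Nu v≢u u≁v
  ... | β , y~β , β~v with only Nv (~-sym β~v)
  ...   | inj₁ refl = contradiction y~β ~-irrefl
  ...   | inj₂ refl = y~β

  -- With N(u) = {z, p} and N(z) = {u, q}, every vertex outside N[u] is adjacent to q;
  -- q itself is not adjacent to q, which forces p = q.
  adjacent-lows-universal : ∀ {u z} → Low u → Low z → u ~ z → ∃ Universal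
  adjacent-lows-universal {u} {z} low-u low-z u~z
    with low⇒∃Neighbourhood₂ low-u u~z | low⇒∃Neighbourhood₂ low-z (~-sym u~z)
  ... | p , Nu | q , Nz = q , universal
    where
    outside-N[u] : ∀ {t} → t ≢ u → t ≢ z → t ≢ p → u ≁ t
    outside-N[u] t≢u t≢z t≢p = ¬-not λ u~t → [ t≢z , t≢p ]′ (only Nu u~t)
    q~outside : ∀ {t} → t ≢ u → u ≁ t → q ~ t
    q~outside t≢u u≁t with two-steps-from Nu t≢u u≁t
    ... | β , z~β , β~t with only Nz z~β
    ...   | inj₁ refl = ⊥-elim (~⇒¬≁ β~t u≁t)
    ...   | inj₂ refl = β~t
    p≡q : p ≡ q
    p≡q with p ≟ q
    ... | yes p≡q = p≡q
    ... | no p≢q  = contradiction (q~outside q≢u (outside-N[u] q≢u (~⇒≢ (v~y Nz) ∘ sym) (p≢q ∘ sym)))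
                                  ~-irrefl
      where
      q≢u : q ≢ u
      q≢u = x≢y Nz ∘ sym
    universal : Universal q
    universal x x≢q with x ≟ u | x ≟ z
    ... | yes refl | _        = subst (_~ u) p≡q (~-sym (v~y Nu))
    ... | no _     | yes refl = ~-sym (v~y Nz)
    ... | no x≢u   | no x≢z   = q~outside x≢u (outside-N[u] x≢u x≢z (λ x≡p → x≢q (trans x≡p p≡q)))

  module _ {p} (universal : Universal p) where

    deg-universal : deg p + 1 ≡ n
    deg-universal = ≤-antisym upper lower
      where
      no-loop : 𝟙 (adj G p p) ≡ 0
      no-loop = cong 𝟙 (adj-irrefl G p)
      upper : deg p + 1 ≤ n
      upper = begin
        deg p + 1              ≤⟨ ∑-≤-outside p (λ i _ → 𝟙≤1 (adj G p i)) ⟩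
        n * 1 + 𝟙 (adj G p p)  ≡⟨ cong₂ _+_ (*-identityʳ n) no-loop ⟩
        n + 0                  ≡⟨ +-identityʳ n ⟩
        n                      ∎
        where open ≤-Reasoning
      lower : n ≤ deg p + 1
      lower = begin
        n                            ≡⟨ trans (+-identityʳ (n * 1)) (*-identityʳ n) ⟨
        n * 1 + 0                    ≡⟨ cong (λ l → n * 1 + (l + 0)) no-loop ⟨
        n * 1 + (𝟙 (adj G p p) + 0)  ≤⟨ ∑-≥-outside [ p ] ([] ∷ [])
                                          (λ i i∉ → ≤-reflexive (cong 𝟙 (sym (universal i (i∉ ∘ here))))) ⟩
        deg p + 1                    ∎
        where open ≤-Reasoning

    windmill : (∀ u → u ≢ p → Low u) → sum deg + 3 ≡ 3 * n
    windmill others-low = begin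
      sum deg + 3          ≡⟨ +-assoc (sum deg) 2 1 ⟨
      sum deg + 2 + 1      ≡⟨ cong (_+ 1) (≤-antisym upper lower) ⟩
      n * 2 + deg p + 1    ≡⟨ +-assoc (n * 2) (deg p) 1 ⟩
      n * 2 + (deg p + 1)  ≡⟨ cong (n * 2 +_) deg-universal ⟩
      n * 2 + n            ≡⟨ triple n ⟩
      3 * n                ∎
      where
      open ≡-Reasoning
      triple : ∀ n → n * 2 + n ≡ 3 * n
      triple = solve-∀
      upper : sum deg + 2 ≤ n * 2 + deg p
      upper = ∑-≤-outside p others-low
      lower : n * 2 + deg p ≤ sum deg + 2
      lower = subst (_≤ sum deg + 2) (cong (n * 2 +_) (+-identityʳ (deg p)))
                    (∑-≥-outside [ p ] ([] ∷ []) (λ u _ → deg≥2 u))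

    adjacent-highs : ∀ {c q} → c ≢ p → q ≢ p → c ~ q → 3 ≤ deg c → 3 ≤ deg q → 3 * n ≤ sum deg + 1
    adjacent-highs {c} {q} c≢p q≢p c~q 3≤deg-c 3≤deg-q = +-cancelʳ-≤ 5 (3 * n) (sum deg + 1) (begin
      3 * n + 5                                          ≡⟨ cong (λ m → 3 * m + 5) deg-universal ⟨
      3 * (deg p + 1) + 5                                ≡⟨ rearrange (deg p) ⟩
      (deg p + 1) * 2 + (deg p + (3 + (3 + 0)))          ≤⟨ +-monoʳ-≤ ((deg p + 1) * 2) (+-monoʳ-≤ (deg p)
                                                              (+-mono-≤ 3≤deg-c (+-monoˡ-≤ 0 3≤deg-q))) ⟩
      (deg p + 1) * 2 + (deg p + (deg c + (deg q + 0)))  ≡⟨ cong (λ m → m * 2 + (deg p + (deg c + (deg q + 0))))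
                                                                 deg-universal ⟩
      n * 2 + (deg p + (deg c + (deg q + 0)))            ≤⟨ ∑-≥-outside (p ∷ c ∷ q ∷ []) distinct
                                                              (λ u _ → deg≥2 u) ⟩
      sum deg + 6                                        ≡⟨ +-assoc (sum deg) 1 5 ⟨
      sum deg + 1 + 5                                    ∎)
      where
      open ≤-Reasoning
      distinct : Unique (p ∷ c ∷ q ∷ [])
      distinct = (c≢p ∘ sym ∷ q≢p ∘ sym ∷ []) ∷ (~⇒≢ c~q ∷ []) ∷ [] ∷ []
      rearrange : ∀ d → 3 * (d + 1) + 5 ≡ (d + 1) * 2 + (d + (3 + (3 + 0)))
      rearrange = solve-∀

    spare-high : ∀ {c} → c ≢ p → ¬ Low c → 3 * n ≤ sum deg + 1
    spare-high {c} c≢p ¬low-c with length<count⇒∃∉ {xs = [ p ]} (≤-trans (s≤s (s≤s z≤n)) (≰⇒> ¬low-c))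
    ... | q₁ , c~q₁ , q₁∉ with length<count⇒∃∉ {xs = p ∷ q₁ ∷ []} (≰⇒> ¬low-c)
    ...   | q₂ , c~q₂ , q₂∉ with low? q₁ | low? q₂
    ...     | no ¬low₁ | _        = adjacent-highs c≢p (q₁∉ ∘ here) c~q₁ (≰⇒> ¬low-c) (≰⇒> ¬low₁)
    ...     | yes _    | no ¬low₂ = adjacent-highs c≢p (q₂∉ ∘ here) c~q₂ (≰⇒> ¬low-c) (≰⇒> ¬low₂)
    ...     | yes low₁ | yes low₂ = ⊥-elim (no-twins N₁ N₂ (q₂≢q₁ ∘ sym) q₁≁q₂)
      where
      q₂≢q₁ : q₂ ≢ q₁
      q₂≢q₁ = q₂∉ ∘ there ∘ here
      N₁ : Neighbourhood₂ q₁ p c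
      N₁ = low⇒Neighbourhood₂ low₁ (c≢p ∘ sym) (~-sym (universal q₁ (q₁∉ ∘ here))) (~-sym c~q₁)
      N₂ : Neighbourhood₂ q₂ p c
      N₂ = low⇒Neighbourhood₂ low₂ (c≢p ∘ sym) (~-sym (universal q₂ (q₂∉ ∘ here))) (~-sym c~q₂)
      q₁≁q₂ : q₁ ≁ q₂
      q₁≁q₂ = ¬-not λ q₁~q₂ → [ q₂∉ ∘ here , ~⇒≢ c~q₂ ∘ sym ]′ (only N₁ q₁~q₂)

    universal-bound : (3 * n ≤ sum deg + 1) ⊎ (3 * n ≡ sum deg + 3)
    universal-bound with any? (λ c → ¬? (c ≟ p) ×-dec ¬? (low? c))
    ... | yes (c , c≢p , ¬low-c) = inj₁ (spare-high c≢p ¬low-c)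
    ... | no none                =
      inj₂ (sym (windmill λ u u≢p → decidable-stable (low? u) λ ¬low → none (u , u≢p , ¬low)))

  module NoUniversal (no-universal : ¬ ∃ Universal) where

    lows-independent : ∀ {u z} → Low u → Low z → ¬ u ~ z
    lows-independent low-u low-z u~z = no-universal (adjacent-lows-universal low-u low-z u~z)

    high-beside-low : ∀ {u z} → Low u → u ~ z → 3 ≤ deg z
    high-beside-low {z = z} low-u u~z with low? z
    ... | yes low-z = contradiction u~z (lows-independent low-u low-z)
    ... | no ¬low-z = ≰⇒> ¬low-z

    module LowNextToDegreeThree {v w y a b} (low-v : Low v) (Nv : Neighbourhood₂ v w y) (deg-w : deg w ≡ 3)
                                (w~a : w ~ a) (w~b : w ~ b) (a≢b : a ≢ b) (a≢v : a ≢ v) (b≢v : b ≢ v) where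

      private
        w≢v : w ≢ v
        w≢v = ~⇒≢ (v~x Nv) ∘ sym
        a≢w : a ≢ w
        a≢w = ~⇒≢ w~a ∘ sym
        b≢w : b ≢ w
        b≢w = ~⇒≢ w~b ∘ sym

      N[w] : ∀ {z} → w ~ z → z ∈ v ∷ a ∷ b ∷ []
      N[w] = count≤length⇒∈ (≤-reflexive deg-w) ((a≢v ∘ sym ∷ b≢v ∘ sym ∷ []) ∷ (a≢b ∷ []) ∷ [] ∷ [])
                            (~-sym (v~x Nv) ∷ w~a ∷ w~b ∷ [])

      y-high : 3 ≤ deg y
      y-high = high-beside-low low-v (v~y Nv)

      v≁ : ∀ {u} → u ≢ w → u ≢ y → v ≁ u
      v≁ u≢w u≢y = ¬-not λ v~u → [ u≢w , u≢y ]′ (only Nv v~u)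

      dominated : ∀ {u} → u ≢ v → u ≢ w → u ≢ y → u ~ a ⊎ u ~ b
      dominated u≢v u≢w u≢y with two-steps-from Nv u≢v (v≁ u≢w u≢y)
      ... | β , w~β , β~u with N[w] w~β
      ...   | here refl                 = ⊥-elim (~⇒¬≁ β~u (v≁ u≢w u≢y))
      ...   | there (here refl)         = inj₁ (~-sym β~u)
      ...   | there (there (here refl)) = inj₂ (~-sym β~u)

      a~b : a ~ b
      a~b with a ≟ y
      ... | no a≢y  = [ ⊥-elim ∘ ~-irrefl , id ]′ (dominated a≢v a≢w a≢y)
      ... | yes a≡y = [ ~-sym , ⊥-elim ∘ ~-irrefl ]′ (dominated b≢v b≢w λ b≡y → a≢b (trans a≡y (sym b≡y)))

      -- f counts the edges at a and b a second time: sum f exceeds the degree sum by deg a + deg b,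
      -- while f ≥ 3 off a, b, w, v by domination.  Beyond these minima the bound needs a surplus of 2,
      -- collected at v and at one or two fresh vertices.
      t f : Fin n → ℕ
      t u = 𝟙 (adj G u a) + 𝟙 (adj G u b)
      f u = deg u + t u

      sum-f : sum f ≡ sum deg + (deg a + deg b)
      sum-f = trans (∑-distrib-+ deg t) (cong (sum deg +_)
                (trans (∑-distrib-+ (λ u → 𝟙 (adj G u a)) (λ u → 𝟙 (adj G u b))) (cong₂ _+_ (column a) (column b))))
        where
        column : ∀ x → sum (λ u → 𝟙 (adj G u x)) ≡ deg x
        column x = sum-cong-≗ (λ u → cong 𝟙 (adj-sym G u x))

      t≥1 : ∀ {u} → u ~ a ⊎ u ~ b → 1 ≤ t u
      t≥1 (inj₁ u~a) = ≤-trans (≤-reflexive (cong 𝟙 (sym u~a))) (m≤m+n _ _)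
      t≥1 (inj₂ u~b) = ≤-trans (≤-reflexive (cong 𝟙 (sym u~b))) (m≤n+m _ _)

      t≥2 : ∀ {u} → u ~ a → u ~ b → 2 ≤ t u
      t≥2 u~a u~b = ≤-reflexive (cong₂ _+_ (cong 𝟙 (sym u~a)) (cong 𝟙 (sym u~b)))

      f≥3 : ∀ {u} → u ≢ v → u ≢ w → 3 ≤ f u
      f≥3 {u} u≢v u≢w with u ≟ y
      ... | yes refl = ≤-trans y-high (m≤m+n (deg y) (t y))
      ... | no u≢y   = +-mono-≤ (deg≥2 u) (t≥1 (dominated u≢v u≢w u≢y))

      f-a : f a ≡ deg a + 1
      f-a = cong (deg a +_) (cong₂ _+_ (cong 𝟙 (adj-irrefl G a)) (cong 𝟙 a~b))

      f-b : f b ≡ deg b + 1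
      f-b = cong (deg b +_) (cong₂ _+_ (cong 𝟙 (~-sym a~b)) (cong 𝟙 (adj-irrefl G b)))

      f-w : f w ≡ 5
      f-w = cong₂ _+_ deg-w (cong₂ _+_ (cong 𝟙 w~a) (cong 𝟙 w~b))

      f-v : f v ≡ 2 + t v
      f-v = cong (_+ t v) (≤-antisym low-v (deg≥2 v))

      Fresh : Fin n → Set
      Fresh z = z ≢ a × z ≢ b × z ≢ w × z ≢ v

      bonus : ∀ {ys} → All Fresh ys → Unique ys → 3 * length ys + 2 ≤ t v + List.sum (map f ys) →
              3 * n ≤ sum deg + 1
      bonus {ys} fresh unique surplus = +-cancelʳ-≤ X (3 * n) (sum deg + 1) (begin
        3 * n + X                                                    ≡⟨ lhs n (deg a) (deg b) L ⟩
        n * 3 + (deg a + 1 + (deg b + 1 + (5 + (2 + (3 * L + 2)))))  ≤⟨ +-monoʳ-≤ (n * 3) (+-monoʳ-≤ (deg a + 1)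
                                                                          (+-monoʳ-≤ (deg b + 1) (+-monoʳ-≤ 5
                                                                            (+-monoʳ-≤ 2 surplus)))) ⟩
        n * 3 + (deg a + 1 + (deg b + 1 + (5 + (2 + (t v + Σys)))))  ≡⟨ cong (n * 3 +_) values ⟨
        n * 3 + (f a + (f b + (f w + (f v + Σys))))                  ≤⟨ ∑-≥-outside (a ∷ b ∷ w ∷ v ∷ ys)
                                                                          all-unique f≥3′ ⟩
        sum f + (3 + (3 + (3 + (3 + L * 3))))                        ≡⟨ cong (_+ _) sum-f ⟩
        sum deg + (deg a + deg b) + (3 + (3 + (3 + (3 + L * 3))))    ≡⟨ rhs (sum deg) (deg a) (deg b) L ⟩
        sum deg + 1 + X                                              ∎)
        where
        open ≤-Reasoning
        L Σys X : ℕ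
        L = length ys
        Σys = List.sum (map f ys)
        X = deg a + deg b + 3 * L + 11
        lhs : ∀ n da db L → 3 * n + (da + db + 3 * L + 11) ≡ n * 3 + (da + 1 + (db + 1 + (5 + (2 + (3 * L + 2)))))
        lhs = solve-∀
        rhs : ∀ S da db L → S + (da + db) + (3 + (3 + (3 + (3 + L * 3)))) ≡ S + 1 + (da + db + 3 * L + 11)
        rhs = solve-∀
        values : f a + (f b + (f w + (f v + Σys))) ≡ deg a + 1 + (deg b + 1 + (5 + (2 + (t v + Σys))))
        values = cong₂ _+_ f-a (cong₂ _+_ f-b (cong₂ _+_ f-w (trans (cong (_+ Σys) f-v) (+-assoc 2 (t v) Σys))))
        all-unique : Unique (a ∷ b ∷ w ∷ v ∷ ys)
        all-unique = (a≢b ∷ a≢w ∷ a≢v ∷ All.map (λ (z≢a , _) → z≢a ∘ sym) fresh)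
                   ∷ (b≢w ∷ b≢v ∷ All.map (λ (_ , z≢b , _) → z≢b ∘ sym) fresh)
                   ∷ (w≢v ∷ All.map (λ (_ , _ , z≢w , _) → z≢w ∘ sym) fresh)
                   ∷ All.map (λ (_ , _ , _ , z≢v) → z≢v ∘ sym) fresh
                   ∷ unique
        f≥3′ : ∀ i → i ∉ a ∷ b ∷ w ∷ v ∷ ys → 3 ≤ f i
        f≥3′ i i∉ = f≥3 (i∉ ∘ there ∘ there ∘ there ∘ here) (i∉ ∘ there ∘ there ∘ here)

      bonus₁ : ∀ {p} → Fresh p → 5 ≤ t v + f p → 3 * n ≤ sum deg + 1
      bonus₁ {p} fresh-p surplus =
        bonus (fresh-p ∷ []) ([] ∷ []) (subst (λ s → 5 ≤ t v + s) (sym (+-identityʳ (f p))) surplus)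

      bonus₂ : ∀ {p q} → Fresh p → Fresh q → p ≢ q → 8 ≤ t v + (f p + f q) → 3 * n ≤ sum deg + 1
      bonus₂ {p} {q} fresh-p fresh-q p≢q surplus =
        bonus (fresh-p ∷ fresh-q ∷ []) ((p≢q ∷ []) ∷ [] ∷ [])
              (subst (λ s → 8 ≤ t v + (f p + s)) (sym (+-identityʳ (f q))) surplus)

      fresh-high : ∀ {z} → Fresh z → z ≢ y → 3 ≤ deg z → 4 ≤ f z
      fresh-high (_ , _ , z≢w , z≢v) z≢y 3≤deg = +-mono-≤ 3≤deg (t≥1 (dominated z≢v z≢w z≢y))

      module Triangle (y∈ab : y ≡ a ⊎ y ≡ b) {u} (u≢a : u ≢ a) (u≢b : u ≢ b) (u≢w : u ≢ w) (u≢v : u ≢ v)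
        where

        ≢y : ∀ {z} → z ≢ a → z ≢ b → z ≢ y
        ≢y z≢a z≢b z≡y = [ z≢a ∘ trans z≡y , z≢b ∘ trans z≡y ]′ y∈ab

        fresh-u : Fresh u
        fresh-u = u≢a , u≢b , u≢w , u≢v

        via-other-neighbour : ∀ {x} → Low u → u ~ x → (∀ {z} → u ~ z → z ≢ x → z ≢ a × z ≢ b) →
                              ∃ λ p → Fresh p × 4 ≤ f p
        via-other-neighbour low-u u~x avoids with low⇒∃Neighbourhood₂ low-u u~x
        ... | z , Nu = z , fresh-z , fresh-high fresh-z (≢y z≢a z≢b) (high-beside-low low-u (v~y Nu))
          where
          z≢a : z ≢ a
          z≢a = proj₁ (avoids (v~y Nu) (x≢y Nu ∘ sym))
          z≢b : z ≢ b
          z≢b = proj₂ (avoids (v~y Nu) (x≢y Nu ∘ sym))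
          z≢w : z ≢ w
          z≢w refl with N[w] (~-sym (v~y Nu))
          ... | here u≡v                 = u≢v u≡v
          ... | there (here u≡a)         = u≢a u≡a
          ... | there (there (here u≡b)) = u≢b u≡b
          z≢v : z ≢ v
          z≢v refl = ~⇒¬≁ (~-sym (v~y Nu)) (v≁ u≢w (≢y u≢a u≢b))
          fresh-z : Fresh z
          fresh-z = z≢a , z≢b , z≢w , z≢v

        heavy-vertex : ∃ λ p → Fresh p × 4 ≤ f p
        heavy-vertex with low? u | u ~? a | u ~? b
        ... | no ¬low-u | _       | _       = u , fresh-u , fresh-high fresh-u (≢y u≢a u≢b) (≰⇒> ¬low-u)
        ... | yes _     | yes u~a | yes u~b = u , fresh-u , +-mono-≤ (deg≥2 u) (t≥2 u~a u~b)
        ... | yes low-u | yes u~a | no ¬u~b =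
          via-other-neighbour low-u u~a λ u~z z≢a → z≢a , λ { refl → ¬u~b u~z }
        ... | yes low-u | no ¬u~a | yes u~b =
          via-other-neighbour low-u u~b λ u~z z≢b → (λ { refl → ¬u~a u~z }) , z≢b
        ... | yes _     | no ¬u~a | no ¬u~b = ⊥-elim ([ ¬u~a , ¬u~b ]′ (dominated u≢v u≢w (≢y u≢a u≢b)))

      triangle-case : y ≡ a ⊎ y ≡ b → 3 * n ≤ sum deg + 1
      triangle-case y∈ab with ∃-fresh (a ∷ b ∷ w ∷ v ∷ []) 5≤n
      ... | u , u∉ with Triangle.heavy-vertex y∈ab (u∉ ∘ here) (u∉ ∘ there ∘ here)
                                              (u∉ ∘ there ∘ there ∘ here) (u∉ ∘ there ∘ there ∘ there ∘ here)
      ...   | p , fresh-p , 4≤f-p = bonus₁ fresh-p (+-mono-≤ (t≥1 v~ab) 4≤f-p)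
        where
        v~ab : v ~ a ⊎ v ~ b
        v~ab = Sum.map (λ y≡a → subst (v ~_) y≡a (v~y Nv)) (λ y≡b → subst (v ~_) y≡b (v~y Nv)) y∈ab

      module NoTriangle (y≢a : y ≢ a) (y≢b : y ≢ b) where

        y≢w : y ≢ w
        y≢w = x≢y Nv ∘ sym

        y≢v : y ≢ v
        y≢v = ~⇒≢ (v~y Nv) ∘ sym

        fresh-y : Fresh y
        fresh-y = y≢a , y≢b , y≢w , y≢v

        y≁w : ¬ y ~ w
        y≁w y~w with N[w] (~-sym y~w)
        ... | here y≡v                 = y≢v y≡v
        ... | there (here y≡a)         = y≢a y≡a
        ... | there (there (here y≡b)) = y≢b y≡b

        far-neighbour : ∀ {z} → y ~ z → z ≢ v → z ≢ a → z ≢ b → Fresh z × 4 ≤ f z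
        far-neighbour {z} y~z z≢v z≢a z≢b = fresh-z , fresh-high fresh-z z≢y z-high
          where
          z≢w : z ≢ w
          z≢w refl = y≁w y~z
          z≢y : z ≢ y
          z≢y = ~⇒≢ y~z ∘ sym
          fresh-z : Fresh z
          fresh-z = z≢a , z≢b , z≢w , z≢v
          z-high : 3 ≤ deg z
          z-high with low? z
          ... | no ¬low-z = ≰⇒> ¬low-z
          ... | yes low-z with low⇒∃Neighbourhood₂ low-z (~-sym y~z)
          ...   | _ , Nz = ⊥-elim (y≁w (shared-neighbour-adjacent (swap Nv) Nz (z≢v ∘ sym) z≁v))
            where
            z≁v : z ≁ v
            z≁v = ¬-not λ z~v → [ z≢w , z≢y ]′ (only Nv (~-sym z~v))

        bound : 3 * n ≤ sum deg + 1
        bound with y ~? a | y ~? b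
        ... | yes y~a | yes y~b = bonus₁ fresh-y (≤-trans (+-mono-≤ y-high (t≥2 y~a y~b)) (m≤n+m (f y) (t v)))
        ... | yes y~a | no ¬y~b with length<count⇒∃∉ {xs = v ∷ a ∷ []} y-high
        ...   | z , y~z , z∉ = bonus₂ fresh-y (proj₁ far) (~⇒≢ y~z)
                                 (≤-trans (+-mono-≤ (+-mono-≤ y-high (t≥1 (inj₁ y~a))) (proj₂ far)) (m≤n+m _ (t v)))
          where
          far : Fresh z × 4 ≤ f z
          far = far-neighbour y~z (z∉ ∘ here) (z∉ ∘ there ∘ here) λ { refl → ¬y~b y~z }
        bound | no ¬y~a | yes y~b with length<count⇒∃∉ {xs = v ∷ b ∷ []} y-high
        ...   | z , y~z , z∉ = bonus₂ fresh-y (proj₁ far) (~⇒≢ y~z)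
                                 (≤-trans (+-mono-≤ (+-mono-≤ y-high (t≥1 (inj₂ y~b))) (proj₂ far)) (m≤n+m _ (t v)))
          where
          far : Fresh z × 4 ≤ f z
          far = far-neighbour y~z (z∉ ∘ here) (λ { refl → ¬y~a y~z }) (z∉ ∘ there ∘ here)
        bound | no ¬y~a | no ¬y~b with length<count⇒∃∉ {xs = [ v ]} (≤-trans (s≤s (s≤s z≤n)) y-high)
        ...   | z₁ , y~z₁ , z₁∉ with length<count⇒∃∉ {xs = v ∷ z₁ ∷ []} y-high
        ...     | z₂ , y~z₂ , z₂∉ = bonus₂ (proj₁ far₁) (proj₁ far₂) (z₂∉ ∘ there ∘ here ∘ sym)
                                      (≤-trans (+-mono-≤ (proj₂ far₁) (proj₂ far₂)) (m≤n+m _ (t v)))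
          where
          far₁ : Fresh z₁ × 4 ≤ f z₁
          far₁ = far-neighbour y~z₁ (z₁∉ ∘ here) (λ { refl → ¬y~a y~z₁ }) (λ { refl → ¬y~b y~z₁ })
          far₂ : Fresh z₂ × 4 ≤ f z₂
          far₂ = far-neighbour y~z₂ (z₂∉ ∘ here) (λ { refl → ¬y~a y~z₂ }) (λ { refl → ¬y~b y~z₂ })

      bound : 3 * n ≤ sum deg + 1
      bound with y ≟ a | y ≟ b
      ... | yes y≡a | _       = triangle-case (inj₁ y≡a)
      ... | no _    | yes y≡b = triangle-case (inj₂ y≡b)
      ... | no y≢a  | no y≢b  = NoTriangle.bound y≢a y≢b

    low-next-to-degree-three : ∀ {v w} → Low v → w ~ v → deg w ≡ 3 → 3 * n ≤ sum deg + 1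
    low-next-to-degree-three {v} low-v w~v deg-w
      with length<count⇒∃∉ {xs = [ v ]} (subst (2 ≤_) (sym deg-w) (s≤s (s≤s z≤n)))
    ... | a , w~a , a∉ with length<count⇒∃∉ {xs = v ∷ a ∷ []} (≤-reflexive (sym deg-w))
    ...   | b , w~b , b∉ with low⇒∃Neighbourhood₂ low-v (~-sym w~v)
    ...     | _ , Nv = LowNextToDegreeThree.bound low-v Nv deg-w w~a w~b
                         (b∉ ∘ there ∘ here ∘ sym) (a∉ ∘ here) (b∉ ∘ here)

    -- Every low vertex receives half a unit from each neighbour; `charge` is the resulting
    -- inequality "final charge ≥ 3", doubled.
    module Discharging (degree-three-avoids-lows : ∀ {v w} → Low v → w ~ v → deg w ≢ 3) where

      lowᵇ : Fin n → Bool
      lowᵇ u = does (low? u)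

      lowNbr : Fin n → Fin n → Bool
      lowNbr u x = adj G u x ∧ lowᵇ x

      lowNbrs highNbrs : Fin n → ℕ
      lowNbrs u  = count (lowNbr u)
      highNbrs u = count (λ x → adj G u x ∧ not (lowᵇ x))

      lowNbr-true : ∀ {u x} → lowNbr u x ≡ true → u ~ x × Low x
      lowNbr-true {x = x} h with ∧-true h
      ... | u~x , low-x =
        u~x , decidable-stable (low? x) λ ¬low → contradiction (trans (sym low-x) (dec-false (low? x) ¬low)) λ ()

      sum-lowNbrs : sum lowNbrs ≡ sum (λ x → 2 * 𝟙 (lowᵇ x))
      sum-lowNbrs = begin
        sum (λ u → sum (λ x → 𝟙 (adj G u x ∧ lowᵇ x)))
          ≡⟨ sum-cong-≗ (λ u → sum-cong-≗ (λ x → 𝟙-∧ (adj G u x) (lowᵇ x))) ⟩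
        sum (λ u → sum (λ x → 𝟙 (adj G u x) * 𝟙 (lowᵇ x)))
          ≡⟨ ∑-comm (λ u x → 𝟙 (adj G u x) * 𝟙 (lowᵇ x)) ⟩
        sum (λ x → sum (λ u → 𝟙 (adj G u x) * 𝟙 (lowᵇ x)))
          ≡⟨ sum-cong-≗ (λ x → *-distribʳ-sum (𝟙 (lowᵇ x)) (λ u → 𝟙 (adj G u x))) ⟨
        sum (λ x → sum (λ u → 𝟙 (adj G u x)) * 𝟙 (lowᵇ x))
          ≡⟨ sum-cong-≗ (λ x → cong (_* 𝟙 (lowᵇ x)) (sum-cong-≗ (λ u → cong 𝟙 (adj-sym G u x)))) ⟩
        sum (λ x → deg x * 𝟙 (lowᵇ x))
          ≡⟨ sum-cong-≗ low-deg ⟩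
        sum (λ x → 2 * 𝟙 (lowᵇ x))
          ∎
        where
        open ≡-Reasoning
        𝟙-∧ : ∀ a b → 𝟙 (a ∧ b) ≡ 𝟙 a * 𝟙 b
        𝟙-∧ false _ = refl
        𝟙-∧ true  b = sym (+-identityʳ (𝟙 b))
        low-deg : ∀ x → deg x * 𝟙 (lowᵇ x) ≡ 2 * 𝟙 (lowᵇ x)
        low-deg x with low? x
        ... | yes low-x = cong (_* 𝟙 (lowᵇ x)) (≤-antisym low-x (deg≥2 x))
        ... | no ¬low-x rewrite dec-false (low? x) ¬low-x = trans (*-zeroʳ (deg x)) (sym (*-zeroʳ 2))

      no-low-nbrs : ∀ {u} → Low u → lowNbrs u ≡ 0
      no-low-nbrs {u} low-u = n≤0⇒n≡0 (⊆⇒count≤length {p = lowNbr u} {xs = []}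
        λ _ h → ⊥-elim (lows-independent low-u (proj₂ (lowNbr-true h)) (proj₁ (lowNbr-true h))))

      one-low-nbr : ∀ {u} → 3 ≤ deg u → 1 ≤ lowNbrs u → 4 ≤ deg u
      one-low-nbr {u} 3≤deg 1≤lowNbrs with length<count⇒∃∉ {p = lowNbr u} {xs = []} 1≤lowNbrs
      ... | _ , h , _ with lowNbr-true h
      ...   | u~x , low-x = ≤∧≢⇒< 3≤deg (degree-three-avoids-lows low-x u~x ∘ sym)

      two-high-nbrs : ∀ {u x₁ x₂} → x₁ ≢ x₂ → u ~ x₁ → u ~ x₂ → Low x₁ → Low x₂ → 2 ≤ highNbrs u
      two-high-nbrs {u} x₁≢x₂ u~x₁ u~x₂ low₁ low₂
        with low⇒∃Neighbourhood₂ low₁ (~-sym u~x₁) | low⇒∃Neighbourhood₂ low₂ (~-sym u~x₂)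
      ... | y₁ , N₁ | y₂ , N₂ =
        unique⇒length≤count ((y₁≢y₂ ∷ []) ∷ [] ∷ []) (high-nbr N₁ N₂ x₁≢x₂ ∷ high-nbr N₂ N₁ (x₁≢x₂ ∘ sym) ∷ [])
        where
        y₁≢y₂ : y₁ ≢ y₂
        y₁≢y₂ refl = no-twins N₁ N₂ x₁≢x₂ (¬-not (lows-independent low₁ low₂))
        high-nbr : ∀ {x x′ y y′} → Neighbourhood₂ x u y → Neighbourhood₂ x′ u y′ → x ≢ x′ →
                   adj G u y ∧ not (lowᵇ y) ≡ true
        high-nbr {x} {x′} {y} Nx Nx′ x≢x′ = begin
          adj G u y ∧ not (lowᵇ y)  ≡⟨ cong (λ b → adj G u y ∧ not b) (dec-false (low? y) ¬low-y) ⟩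
          adj G u y ∧ true          ≡⟨ ∧-identityʳ (adj G u y) ⟩
          adj G u y                 ≡⟨ shared-neighbour-adjacent Nx Nx′ x≢x′ x′≁x ⟩
          true                      ∎
          where
          open ≡-Reasoning
          ¬low-y : ¬ Low y
          ¬low-y = <⇒≱ (high-beside-low (Neighbourhood₂⇒low Nx) (v~y Nx))
          x′≁x : x′ ≁ x
          x′≁x = ¬-not (lows-independent (Neighbourhood₂⇒low Nx′) (Neighbourhood₂⇒low Nx))

      two-low-nbrs : ∀ {u} → 2 ≤ lowNbrs u → 2 ≤ highNbrs u
      two-low-nbrs {u} 2≤lowNbrs with length<count⇒∃∉ {p = lowNbr u} {xs = []} (≤-trans (s≤s z≤n) 2≤lowNbrs)
      ... | x₁ , h₁ , _ with length<count⇒∃∉ {p = lowNbr u} {xs = [ x₁ ]} 2≤lowNbrs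
      ...   | x₂ , h₂ , x₂∉ = two-high-nbrs (x₂∉ ∘ here ∘ sym) (proj₁ (lowNbr-true h₁)) (proj₁ (lowNbr-true h₂))
                                            (proj₂ (lowNbr-true h₁)) (proj₂ (lowNbr-true h₂))

      high-charge : ∀ {u} → 3 ≤ deg u → 6 + lowNbrs u ≤ 2 * deg u
      high-charge {u} 3≤deg with lowNbrs u in eq
      ... | zero        = *-monoʳ-≤ 2 3≤deg
      ... | suc zero    = ≤-trans (n≤1+n 7) (*-monoʳ-≤ 2 (one-low-nbr 3≤deg (≤-reflexive (sym eq))))
      ... | suc (suc k) = begin
        6 + suc (suc k)                 ≤⟨ m≤m+n (6 + suc (suc k)) k ⟩
        6 + suc (suc k) + k             ≡⟨ rearrange k ⟩
        2 * (suc (suc k) + 2)           ≤⟨ *-monoʳ-≤ 2 (+-monoʳ-≤ (suc (suc k)) 2≤highNbrs) ⟩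
        2 * (suc (suc k) + highNbrs u)  ≡⟨ cong (2 *_) deg≡ ⟨
        2 * deg u                       ∎
        where
        open ≤-Reasoning
        2≤highNbrs : 2 ≤ highNbrs u
        2≤highNbrs = two-low-nbrs (subst (2 ≤_) (sym eq) (s≤s (s≤s z≤n)))
        deg≡ : deg u ≡ suc (suc k) + highNbrs u
        deg≡ = trans (count-∧-split (adj G u) lowᵇ) (cong (_+ highNbrs u) eq)
        rearrange : ∀ k → 6 + suc (suc k) + k ≡ 2 * (suc (suc k) + 2)
        rearrange = solve-∀

      charge : ∀ u → 6 + lowNbrs u ≤ 2 * deg u + 2 * 𝟙 (lowᵇ u)
      charge u with low? u
      ... | no ¬low-u = ≤-trans (high-charge (≰⇒> ¬low-u)) (m≤m+n (2 * deg u) _)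
      ... | yes low-u = begin
        6 + lowNbrs u               ≡⟨ cong (6 +_) (no-low-nbrs low-u) ⟩
        2 * 2 + 2 * 1               ≤⟨ +-monoˡ-≤ (2 * 1) (*-monoʳ-≤ 2 (deg≥2 u)) ⟩
        2 * deg u + 2 * 1           ≡⟨ cong (λ b → 2 * deg u + 2 * 𝟙 b) (dec-true (low? u) low-u) ⟨
        2 * deg u + 2 * 𝟙 (lowᵇ u)  ∎
        where open ≤-Reasoning

      bound : 3 * n ≤ sum deg + 1
      bound = ≤-trans (*-cancelˡ-≤ 2 (+-cancelʳ-≤ X (2 * (3 * n)) (2 * sum deg) (begin
        2 * (3 * n) + X                         ≡⟨ cong (_+ X) (trans (six n) (sym (∑-const n 6))) ⟩
        sum {n} (const 6) + X                   ≡⟨ cong (sum {n} (const 6) +_) sum-lowNbrs ⟨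
        sum {n} (const 6) + sum lowNbrs         ≡⟨ ∑-distrib-+ (const 6) lowNbrs ⟨
        sum (λ u → 6 + lowNbrs u)               ≤⟨ ∑-mono-≤ charge ⟩
        sum (λ u → 2 * deg u + 2 * 𝟙 (lowᵇ u))  ≡⟨ ∑-distrib-+ (λ u → 2 * deg u) (λ u → 2 * 𝟙 (lowᵇ u)) ⟩
        sum (λ u → 2 * deg u) + X               ≡⟨ cong (_+ X) (*-distribˡ-sum 2 deg) ⟨
        2 * sum deg + X                         ∎))) (m≤m+n (sum deg) 1)
        where
        open ≤-Reasoning
        X : ℕ
        X = sum (λ u → 2 * 𝟙 (lowᵇ u))
        six : ∀ n → 2 * (3 * n) ≡ n * 6
        six = solve-∀

    bound : 3 * n ≤ sum deg + 1
    bound with any? (λ v → any? (λ w → low? v ×-dec (w ~? v ×-dec (deg w ≟ℕ 3))))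
    ... | yes (_ , _ , low-v , w~v , deg-w) = low-next-to-degree-three low-v w~v deg-w
    ... | no none = Discharging.bound λ low-v w~v deg-w → none (_ , _ , low-v , w~v , deg-w)

  degree-sum-bound : (3 * n ≤ sum deg + 1) ⊎ (3 * n ≡ sum deg + 3)
  degree-sum-bound with any? (λ p → all? (λ x → ¬? (x ≟ p) →-dec (p ~? x)))
  ... | yes (_ , universal) = universal-bound universal
  ... | no no-universal     = inj₁ (NoUniversal.bound no-universal)

-- Parity

halve : ∀ n → n ≡ ⌊ n /2⌋ + ⌊ n /2⌋ ⊎ n ≡ suc (⌊ n /2⌋ + ⌊ n /2⌋)
halve zero          = inj₁ refl
halve (suc zero)    = inj₂ refl
halve (suc (suc n)) = Sum.map (λ even → trans (cong (2 +_) even) two-more)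
                              (λ odd → trans (cong (2 +_) odd) (cong (1 +_) two-more)) (halve n)
  where
  two-more : 2 + (⌊ n /2⌋ + ⌊ n /2⌋) ≡ suc ⌊ n /2⌋ + suc ⌊ n /2⌋
  two-more = cong (1 +_) (sym (+-suc ⌊ n /2⌋ ⌊ n /2⌋))

*-cancelˡ-≤-odd : ∀ {a b} → 2 * a ≤ 2 * b + 1 → a ≤ b
*-cancelˡ-≤-odd {a} {b} 2a≤2b+1 = ≤-pred (*-cancelˡ-< 2 a (suc b) (begin-strict
  2 * a            ≤⟨ 2a≤2b+1 ⟩
  2 * b + 1        <⟨ n<1+n (2 * b + 1) ⟩
  suc (2 * b + 1)  ≡⟨ rearrange b ⟩
  2 * suc b        ∎))
  where
  open ≤-Reasoning
  rearrange : ∀ b → suc (2 * b + 1) ≡ 2 * suc b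
  rearrange = solve-∀

three-halves : ∀ {n e} → (3 * n ≤ 2 * e + 1) ⊎ (3 * n ≡ 2 * e + 3) → 3 * ⌊ n /2⌋ ≤ e
three-halves {n} {e} bound with halve n
... | inj₁ even =
  [ *-cancelˡ-≤-odd ∘ subst (_≤ 2 * e + 1) six-h , ⊥-elim ∘ even≢odd (3 * h) (suc e) ∘ odd-sum ]′ bound
  where
  h : ℕ
  h = ⌊ n /2⌋
  six-h : 3 * n ≡ 2 * (3 * h)
  six-h = trans (cong (3 *_) even) (rearrange h)
    where rearrange : ∀ h → 3 * (h + h) ≡ 2 * (3 * h)
          rearrange = solve-∀
  odd-sum : 3 * n ≡ 2 * e + 3 → 2 * (3 * h) ≡ suc (2 * suc e)
  odd-sum eq = trans (sym six-h) (trans eq (rearrange e))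
    where rearrange : ∀ e → 2 * e + 3 ≡ suc (2 * suc e)
          rearrange = solve-∀
... | inj₂ odd = *-cancelˡ-≤ 2 (+-cancelʳ-≤ 3 (2 * (3 * h)) (2 * e) (begin
  2 * (3 * h) + 3  ≡⟨ rearrange h ⟩
  3 * suc (h + h)  ≡⟨ cong (3 *_) odd ⟨
  3 * n            ≤⟨ [ (λ le → ≤-trans le (+-monoʳ-≤ (2 * e) (s≤s z≤n))) , ≤-reflexive ]′ bound ⟩
  2 * e + 3        ∎))
  where
  open ≤-Reasoning
  h : ℕ
  h = ⌊ n /2⌋
  rearrange : ∀ h → 2 * (3 * h) + 3 ≡ 3 * suc (h + h)
  rearrange = solve-∀

-- For n = suc m, ⌈ (n ∸ 1) /2⌉ is ⌊ n /2⌋ by definition.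
proposition3p1 : ∀ (n : ℕ) → 5 ≤ n → RsatC4AtLeast n (3 * ⌈ (n ∸ 1) /2⌉)
proposition3p1 (suc m) 5≤n G C saturated =
  three-halves {suc m} (subst (λ s → (3 * suc m ≤ s + 1) ⊎ (3 * suc m ≡ s + 3)) (Graph.handshake G)
                              (Saturated.degree-sum-bound 5≤n G C saturated))
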